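{- Let $A$ be a set of non-negative integers of cardinality $m \ge 1$ and let $n \ge 1$. Then the parity function on $A^n$ can be weakly sign represented by a polynomial $P(X_1,\ldots,X_n) \in \mathbb{R}[X_1,\ldots,X_n]$ of sparsity at most $\binom{n+m-1}{n}$ and total degree at most $n \cdot \binom{n+m-1}{n}$.
   Context: For $A \subseteq \mathbb{Z}$, the parity function $\mathrm{Par}: A^n \to \{0,1\}$ is $\mathrm{Par}(a_1,\ldots,a_n) = \sum_{i=1}^n a_i \bmod 2$. A polynomial $P$ weakly sign represents $f: A^n \to \{0,1\}$ if for every $a \in A^n$: $f(a) = 0 \Rightarrow P(a) \ge 0$ and $f(a) = 1 \Rightarrow P(a) \le 0$, and $P(a) \neq 0$ for at least one $a \in A^n$. The sparsity of $P$ is the number of monomials with nonzero coefficient in the standard monomial basis. -}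

module Defs where

open import Data.Nat using (ℕ; _%_; _^_; _⊔_)
open import Data.Integer using (ℤ; +_; _*_; _+_; _≤_)
open import Data.List using (List; map; length; foldr)
open import Data.List.Membership.Propositional using (_∈_)
open import Data.List.Relation.Unary.All using () renaming (All to AllL)
open import Data.List.Relation.Unary.Unique.Propositional using (Unique)
open import Data.Vec using (Vec; zipWith; toList)
open import Data.Vec.Relation.Unary.All using (All)
open import Data.Product using (_×_; proj₁; proj₂; ∃-syntax; Σ-syntax)
open import Relation.Binary.PropositionalEquality using (_≡_; _≢_)

Term : ℕ → Set
Term n = ℤ × Vec ℕ n

-- A polynomial in X_1..X_n written in the standard monomial basis:
-- a finite list of monomials with pairwise distinct exponent vectors
-- and nonzero coefficients (so its length is exactly the sparsity).
record Poly (n : ℕ) : Set where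
  field
    terms    : List (Term n)
    distinct : Unique (map proj₂ terms)
    nonzero  : AllL (λ t → proj₁ t ≢ + 0) terms
open Poly public

sumℕ : List ℕ → ℕ
sumℕ = foldr Data.Nat._+_ 0

prodℕ : List ℕ → ℕ
prodℕ = foldr Data.Nat._*_ 1

monoVal : ∀ {n} → Vec ℕ n → Vec ℕ n → ℕ
monoVal a e = prodℕ (toList (zipWith _^_ a e))

eval : ∀ {n} → Poly n → Vec ℕ n → ℤ
eval P a = foldr (λ t acc → proj₁ t * + monoVal a (proj₂ t) + acc) (+ 0) (terms P)

sparsity : ∀ {n} → Poly n → ℕ
sparsity P = length (terms P)

-- total degree (0 for the zero polynomial)
totalDegree : ∀ {n} → Poly n → ℕ
totalDegree P = foldr (λ t acc → sumℕ (toList (proj₂ t)) ⊔ acc) 0 (terms P)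

Par : ∀ {n} → Vec ℕ n → ℕ
Par a = sumℕ (toList a) % 2

WeaklySignRepresents : ∀ {n} → List ℕ → (Vec ℕ n → ℕ) → Poly n → Set
WeaklySignRepresents {n} A f P =
  ((a : Vec ℕ n) → All (_∈ A) a →
      (f a ≡ 0 → + 0 ≤ eval P a) × (f a ≡ 1 → eval P a ≤ + 0))
  × (∃[ a ] (All (_∈ A) a × eval P a ≢ + 0))

{-# OPTIONS --safe #-}
-- Let M = max A. Every a ∈ Aⁿ other than (M, …, M) has X₁⋯Xₙ(a) < Mⁿ, and the products
-- x₁⋯xₙ over the n-element multisets of A are at most (n+m-1 choose n) numbers, one of
-- which is Mⁿ itself. So g(y) = ±∏ (y - v), over the products v < Mⁿ, has at most that
-- many coefficients, and P = g(X₁⋯Xₙ) vanishes on Aⁿ except at (M, …, M), where the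
-- sign is chosen to match the parity there. Nothing about parity is used beyond its value
-- at that one point, so the construction represents every function on Aⁿ.
module Submission where

open import Defs
open import Data.Nat using (ℕ; _≤_; _+_; _∸_; _*_)
open import Data.Nat.Combinatorics using (_C_)
open import Data.List using (List; length)
open import Data.List.Relation.Unary.Unique.Propositional using (Unique)
open import Data.Product using (_×_; ∃-syntax)
open import Relation.Binary.PropositionalEquality using (_≡_)

open import Algebra.Properties.CommutativeSemigroup using (interchange; x∙yz≈y∙xz)
open import Data.Integer using (ℤ; +_; -_; 0ℤ; 1ℤ; -1ℤ; +≤+; -≤+; +<+)
  renaming (_+_ to _+ℤ_; _*_ to _*ℤ_; _-_ to _-ℤ_; _≤_ to _≤ℤ_; _<_ to _<ℤ_)
import Data.Integer.Properties as ℤ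
open import Data.Integer.Tactic.RingSolver using (solve-∀)
open import Data.List using ([]; _∷_; _++_; map; filter)
import Data.Nat.Properties as ℕ
open import Data.List.Extrema ℕ.≤-totalOrder using (max; ⊥≤max; xs≤max; argmax-sel)
open import Data.List.Membership.Propositional using (_∈_)
open import Data.List.Membership.Propositional.Properties
  using (∈-map⁺; ∈-map⁻; ∈-++⁺ˡ; ∈-++⁺ʳ; ∈-++⁻; ∈-filter⁺)
open import Data.List.Properties using (length-++; length-map; filter-notAll)
open import Data.List.Relation.Unary.All using ([]; _∷_) renaming (All to AllL)
import Data.List.Relation.Unary.All as AllL
open import Data.List.Relation.Unary.All.Properties using (all-filter)
open import Data.List.Relation.Unary.AllPairs using ([]; _∷_)
open import Data.List.Relation.Unary.Any using (here; there)
import Data.List.Relation.Unary.Any as Any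
open import Data.Nat using (zero; suc; _<_; _^_; _<?_; z≤n; s≤s; z<s)
open import Data.Nat.Combinatorics using (nCk+nC[k+1]≡[n+1]C[k+1]; k>n⇒nCk≡0)
open import Data.Product using (_,_; proj₁; proj₂)
open import Data.Sum using (_⊎_; inj₁; inj₂; [_,_]′)
open import Data.Vec using (Vec; []; _∷_; replicate; toList; head)
open import Data.Vec.Relation.Unary.All using (All; []; _∷_)
import Data.Vec.Relation.Unary.All as All
open import Function using (id)
open import Relation.Binary.PropositionalEquality
  using (refl; sym; trans; cong; cong₂; subst; _≢_; module ≡-Reasoning)
open import Relation.Nullary using (yes; no; contradiction)

-- Products of multisets

multisetProducts : ℕ → List ℕ → List ℕ
multisetProducts zero    A       = 1 ∷ []
multisetProducts (suc n) []      = []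
multisetProducts (suc n) (x ∷ A) =
  map (x *_) (multisetProducts n (x ∷ A)) ++ multisetProducts (suc n) A

length-multisetProducts : ∀ n A → length (multisetProducts n A) ≡ (n + length A ∸ 1) C n
length-multisetProducts zero    A       = refl
length-multisetProducts (suc n) []      =
  sym (k>n⇒nCk≡0 (s≤s (ℕ.≤-reflexive (ℕ.+-identityʳ n))))
length-multisetProducts (suc n) (x ∷ A) = begin
  length (map (x *_) (multisetProducts n (x ∷ A)) ++ multisetProducts (suc n) A)
    ≡⟨ length-++ (map (x *_) (multisetProducts n (x ∷ A))) ⟩
  length (map (x *_) (multisetProducts n (x ∷ A))) + length (multisetProducts (suc n) A)
    ≡⟨ cong (_+ length (multisetProducts (suc n) A)) (length-map (x *_) (multisetProducts n (x ∷ A))) ⟩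
  length (multisetProducts n (x ∷ A)) + length (multisetProducts (suc n) A)
    ≡⟨ cong₂ _+_ (length-multisetProducts n (x ∷ A)) (length-multisetProducts (suc n) A) ⟩
  (n + suc (length A) ∸ 1) C n + (n + length A) C suc n
    ≡⟨ cong (λ k → (k ∸ 1) C n + (n + length A) C suc n) (ℕ.+-suc n (length A)) ⟩
  (n + length A) C n + (n + length A) C suc n
    ≡⟨ nCk+nC[k+1]≡[n+1]C[k+1] (n + length A) n ⟩
  suc (n + length A) C suc n
    ≡⟨ cong (_C suc n) (ℕ.+-suc n (length A)) ⟨
  (n + suc (length A)) C suc n
    ∎
  where open ≡-Reasoning

*-∈-multisetProducts : ∀ {x p} n {A} → x ∈ A → p ∈ multisetProducts n A →
                       x * p ∈ multisetProducts (suc n) A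
*-∈-multisetProducts {x} n {z ∷ A} (here refl) p∈ = ∈-++⁺ˡ (∈-map⁺ (x *_) p∈)
*-∈-multisetProducts zero {z ∷ A} (there x∈A) (here refl) =
  there (*-∈-multisetProducts zero x∈A (here refl))
*-∈-multisetProducts {x} {p} (suc n) {z ∷ A} (there x∈A) p∈ =
  [ viaHead , (λ p∈ʳ → ∈-++⁺ʳ _ (*-∈-multisetProducts (suc n) x∈A p∈ʳ)) ]′
    (∈-++⁻ (map (z *_) (multisetProducts n (z ∷ A))) p∈)
  where
  viaHead : p ∈ map (z *_) (multisetProducts n (z ∷ A)) → x * p ∈ multisetProducts (suc (suc n)) (z ∷ A)
  viaHead p∈ˡ with q , q∈ , refl ← ∈-map⁻ (z *_) p∈ˡ =
    subst (_∈ multisetProducts (suc (suc n)) (z ∷ A)) (x∙yz≈y∙xz ℕ.*-commutativeSemigroup z x q)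
      (∈-++⁺ˡ (∈-map⁺ (z *_) (*-∈-multisetProducts n (there x∈A) q∈)))

product-∈-multisetProducts : ∀ {n A} {a : Vec ℕ n} → All (_∈ A) a →
                             prodℕ (toList a) ∈ multisetProducts n A
product-∈-multisetProducts []                      = here refl
product-∈-multisetProducts {suc n} (x∈A ∷ a∈Aⁿ) =
  *-∈-multisetProducts n x∈A (product-∈-multisetProducts a∈Aⁿ)

length-filter-<-∈ : ∀ {K xs} → K ∈ xs → length (filter (_<? K) xs) < length xs
length-filter-<-∈ {K} {xs} K∈xs =
  filter-notAll (_<? K) xs (Any.map (λ { refl → ℕ.<-irrefl refl }) K∈xs)

max-∈ : ∀ x A → max x A ∈ x ∷ A
max-∈ x A = [ here , there ]′ (argmax-sel id x A)

≤-max : ∀ x A → AllL (_≤ max x A) (x ∷ A)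
≤-max x A = ⊥≤max x A ∷ xs≤max x A

replicate⁺ : ∀ {P : ℕ → Set} n {x} → P x → All P (replicate n x)
replicate⁺ zero    px = []
replicate⁺ (suc n) px = px ∷ replicate⁺ n px

product-replicate : ∀ n x → prodℕ (toList (replicate n x)) ≡ x ^ n
product-replicate zero    x = refl
product-replicate (suc n) x = cong (x *_) (product-replicate n x)

product-≤-pow : ∀ {n} M {a : Vec ℕ n} → All (_≤ M) a → prodℕ (toList a) ≤ M ^ n
product-≤-pow M []           = ℕ.≤-refl
product-≤-pow M (x≤M ∷ a≤M) = ℕ.*-mono-≤ x≤M (product-≤-pow M a≤M)

≤0⇒≡replicate0 : ∀ {n} {a : Vec ℕ n} → All (_≤ 0) a → a ≡ replicate n 0
≤0⇒≡replicate0 []            = refl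
≤0⇒≡replicate0 (z≤n ∷ a≤0) = cong (0 ∷_) (≤0⇒≡replicate0 a≤0)

pow-≤-product⇒≡replicate : ∀ {n} M {a : Vec ℕ n} → All (_≤ M) a → M ^ n ≤ prodℕ (toList a) →
                           a ≡ replicate n M
pow-≤-product⇒≡replicate zero a≤0 _ = ≤0⇒≡replicate0 a≤0
pow-≤-product⇒≡replicate (suc _) [] _ = refl
pow-≤-product⇒≡replicate {suc n} M@(suc _) {x ∷ a} (x≤M ∷ a≤M) Mⁿ≤xa with ℕ.m≤n⇒m<n∨m≡n x≤M
... | inj₂ refl = cong (x ∷_) (pow-≤-product⇒≡replicate M a≤M (ℕ.*-cancelˡ-≤ M Mⁿ≤xa))
... | inj₁ x<M  = contradiction Mⁿ≤xa (ℕ.<⇒≱ (begin-strict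
  x * prodℕ (toList a) ≤⟨ ℕ.*-monoʳ-≤ x (product-≤-pow M a≤M) ⟩
  x * M ^ n            <⟨ ℕ.*-monoˡ-< (M ^ n) {{ℕ.m^n≢0 M n}} x<M ⟩
  M * M ^ n            ∎))
  where open ℕ.≤-Reasoning

-- Univariate polynomials as coefficient lists

horner : List ℤ → ℤ → ℤ
horner []       y = 0ℤ
horner (c ∷ cs) y = c +ℤ y *ℤ horner cs y

addCoeffs : List ℤ → List ℤ → List ℤ
addCoeffs []       qs       = qs
addCoeffs (p ∷ ps) []       = p ∷ ps
addCoeffs (p ∷ ps) (q ∷ qs) = p +ℤ q ∷ addCoeffs ps qs

horner-addCoeffs : ∀ ps qs y → horner (addCoeffs ps qs) y ≡ horner ps y +ℤ horner qs y
horner-addCoeffs []       qs       y = sym (ℤ.+-identityˡ (horner qs y))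
horner-addCoeffs (p ∷ ps) []       y = sym (ℤ.+-identityʳ (horner (p ∷ ps) y))
horner-addCoeffs (p ∷ ps) (q ∷ qs) y rewrite horner-addCoeffs ps qs y = rearrange p q y _ _
  where
  rearrange : ∀ p q y a b → p +ℤ q +ℤ y *ℤ (a +ℤ b) ≡ p +ℤ y *ℤ a +ℤ (q +ℤ y *ℤ b)
  rearrange = solve-∀

horner-scale : ∀ w cs y → horner (map (w *ℤ_) cs) y ≡ w *ℤ horner cs y
horner-scale w []       y = sym (ℤ.*-zeroʳ w)
horner-scale w (c ∷ cs) y rewrite horner-scale w cs y = distrib w c y _
  where
  distrib : ∀ w c y h → w *ℤ c +ℤ y *ℤ (w *ℤ h) ≡ w *ℤ (c +ℤ y *ℤ h)
  distrib = solve-∀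

length-addCoeffs : ∀ ps qs → length qs ≤ length ps → length (addCoeffs ps qs) ≡ length ps
length-addCoeffs []       []       _         = refl
length-addCoeffs (p ∷ ps) []       _         = refl
length-addCoeffs (p ∷ ps) (q ∷ qs) (s≤s q≤p) = cong suc (length-addCoeffs ps qs q≤p)

-- (y - v) · g(y) = y · g(y) - v · g(y)
mulLinear : ℕ → List ℤ → List ℤ
mulLinear v cs = addCoeffs (0ℤ ∷ cs) (map (- + v *ℤ_) cs)

horner-mulLinear : ∀ v cs y → horner (mulLinear v cs) y ≡ (y -ℤ + v) *ℤ horner cs y
horner-mulLinear v cs y
  rewrite horner-addCoeffs (0ℤ ∷ cs) (map (- + v *ℤ_) cs) y | horner-scale (- + v) cs y
  = factor y (- + v) (horner cs y)
  where
  factor : ∀ y w h → 0ℤ +ℤ y *ℤ h +ℤ w *ℤ h ≡ (y +ℤ w) *ℤ h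
  factor = solve-∀

length-mulLinear : ∀ v cs → length (mulLinear v cs) ≡ suc (length cs)
length-mulLinear v cs = length-addCoeffs (0ℤ ∷ cs) (map (- + v *ℤ_) cs)
  (ℕ.≤-trans (ℕ.≤-reflexive (length-map _ cs)) (ℕ.n≤1+n (length cs)))

monicWithRoots : List ℕ → List ℤ
monicWithRoots []       = 1ℤ ∷ []
monicWithRoots (v ∷ vs) = mulLinear v (monicWithRoots vs)

length-monicWithRoots : ∀ vs → length (monicWithRoots vs) ≡ suc (length vs)
length-monicWithRoots []       = refl
length-monicWithRoots (v ∷ vs) =
  trans (length-mulLinear v (monicWithRoots vs)) (cong suc (length-monicWithRoots vs))

horner-monicWithRoots-root : ∀ {v vs} → v ∈ vs → horner (monicWithRoots vs) (+ v) ≡ 0ℤ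
horner-monicWithRoots-root {v} {v ∷ vs} (here refl) =
  trans (horner-mulLinear v (monicWithRoots vs) (+ v))
        (cong (_*ℤ horner (monicWithRoots vs) (+ v)) (ℤ.+-inverseʳ (+ v)))
horner-monicWithRoots-root {v} {w ∷ vs} (there v∈vs) =
  trans (horner-mulLinear w (monicWithRoots vs) (+ v))
        (trans (cong ((+ v -ℤ + w) *ℤ_) (horner-monicWithRoots-root v∈vs)) (ℤ.*-zeroʳ (+ v -ℤ + w)))

*-pos : ∀ {i j} → 0ℤ <ℤ i → 0ℤ <ℤ j → 0ℤ <ℤ i *ℤ j
*-pos (+<+ z<s) (+<+ z<s) = +<+ z<s

horner-monicWithRoots-pos : ∀ {y vs} → AllL (_< y) vs → 0ℤ <ℤ horner (monicWithRoots vs) (+ y)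
horner-monicWithRoots-pos {y} [] rewrite ℤ.*-zeroʳ (+ y) = +<+ z<s
horner-monicWithRoots-pos {y} {v ∷ vs} (v<y ∷ vs<y)
  rewrite horner-mulLinear v (monicWithRoots vs) (+ y) =
  *-pos y-v>0 (horner-monicWithRoots-pos vs<y)
  where
  y-v>0 : 0ℤ <ℤ + y -ℤ + v
  y-v>0 rewrite ℤ.m-n≡m⊖n y v | ℤ.⊖-≥ (ℕ.<⇒≤ v<y) = +<+ (ℕ.m<n⇒0<n∸m v<y)

-- The polynomial g(X₁ ⋯ Xₙ) in the monomial basis

productTerms : ∀ n → ℕ → List ℤ → List (Term n)
productTerms n j []       = []
productTerms n j (c ∷ cs) with c ℤ.≟ 0ℤ
... | yes _ = productTerms n (suc j) cs
... | no  _ = (c , replicate n j) ∷ productTerms n (suc j) cs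

productTerms-nonzero : ∀ n j cs → AllL (λ t → proj₁ t ≢ 0ℤ) (productTerms n j cs)
productTerms-nonzero n j []       = []
productTerms-nonzero n j (c ∷ cs) with c ℤ.≟ 0ℤ
... | yes _   = productTerms-nonzero n (suc j) cs
... | no  c≢0 = c≢0 ∷ productTerms-nonzero n (suc j) cs

productTerms-exponents-≥ : ∀ n j cs → AllL (λ e → j ≤ head e) (map proj₂ (productTerms (suc n) j cs))
productTerms-exponents-≥ n j []       = []
productTerms-exponents-≥ n j (c ∷ cs) with c ℤ.≟ 0ℤ
... | yes _ = AllL.map ℕ.<⇒≤ (productTerms-exponents-≥ n (suc j) cs)
... | no  _ = ℕ.≤-refl ∷ AllL.map ℕ.<⇒≤ (productTerms-exponents-≥ n (suc j) cs)

productTerms-distinct : ∀ n j cs → Unique (map proj₂ (productTerms (suc n) j cs))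
productTerms-distinct n j []       = []
productTerms-distinct n j (c ∷ cs) with c ℤ.≟ 0ℤ
... | yes _ = productTerms-distinct n (suc j) cs
... | no  _ = AllL.map (λ j<e j≡e → ℕ.<-irrefl (cong head j≡e) j<e) (productTerms-exponents-≥ n (suc j) cs)
            ∷ productTerms-distinct n (suc j) cs

ofProductFrom : ∀ n → ℕ → List ℤ → Poly (suc n)
ofProductFrom n j cs = record
  { terms    = productTerms (suc n) j cs
  ; distinct = productTerms-distinct n j cs
  ; nonzero  = productTerms-nonzero (suc n) j cs
  }

^-distribʳ-* : ∀ x y j → (x * y) ^ j ≡ x ^ j * y ^ j
^-distribʳ-* x y zero    = refl
^-distribʳ-* x y (suc j) =
  trans (cong (x * y *_) (^-distribʳ-* x y j)) (interchange ℕ.*-commutativeSemigroup x y (x ^ j) (y ^ j))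

monoVal-replicate : ∀ {n} (a : Vec ℕ n) j → monoVal a (replicate n j) ≡ prodℕ (toList a) ^ j
monoVal-replicate []      j = sym (ℕ.^-zeroˡ j)
monoVal-replicate (x ∷ a) j =
  trans (cong (x ^ j *_) (monoVal-replicate a j)) (sym (^-distribʳ-* x (prodℕ (toList a)) j))

pow-horner-step : ∀ c x j h →
  c *ℤ + (x ^ j) +ℤ + (x ^ suc j) *ℤ h ≡ + (x ^ j) *ℤ (c +ℤ + x *ℤ h)
pow-horner-step c x j h =
  trans (cong (λ p → c *ℤ + (x ^ j) +ℤ p *ℤ h) (ℤ.pos-* x (x ^ j))) (factor c (+ (x ^ j)) (+ x) h)
  where
  factor : ∀ c p y h → c *ℤ p +ℤ y *ℤ p *ℤ h ≡ p *ℤ (c +ℤ y *ℤ h)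
  factor = solve-∀

eval-ofProductFrom : ∀ n j cs (a : Vec ℕ (suc n)) →
  eval (ofProductFrom n j cs) a ≡ + (prodℕ (toList a) ^ j) *ℤ horner cs (+ prodℕ (toList a))
eval-ofProductFrom n j []       a = sym (ℤ.*-zeroʳ (+ (prodℕ (toList a) ^ j)))
eval-ofProductFrom n j (c ∷ cs) a with c ℤ.≟ 0ℤ
... | yes refl = trans (eval-ofProductFrom n (suc j) cs a)
                       (trans (sym (ℤ.+-identityˡ _)) (pow-horner-step 0ℤ (prodℕ (toList a)) j _))
... | no  _    = trans (cong₂ (λ u v → c *ℤ + u +ℤ v) (monoVal-replicate a j)
                                                   (eval-ofProductFrom n (suc j) cs a))
                       (pow-horner-step c (prodℕ (toList a)) j _)

sparsity-ofProductFrom : ∀ n j cs → sparsity (ofProductFrom n j cs) ≤ length cs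
sparsity-ofProductFrom n j []       = z≤n
sparsity-ofProductFrom n j (c ∷ cs) with c ℤ.≟ 0ℤ
... | yes _ = ℕ.m≤n⇒m≤1+n (sparsity-ofProductFrom n (suc j) cs)
... | no  _ = s≤s (sparsity-ofProductFrom n (suc j) cs)

sum-replicate : ∀ n j → sumℕ (toList (replicate n j)) ≡ n * j
sum-replicate zero    j = refl
sum-replicate (suc n) j = cong (λ k → j + k) (sum-replicate n j)

totalDegree-ofProductFrom : ∀ n j cs → totalDegree (ofProductFrom n j cs) ≤ suc n * (j + length cs)
totalDegree-ofProductFrom n j []       = z≤n
totalDegree-ofProductFrom n j (c ∷ cs) rewrite ℕ.+-suc j (length cs) with c ℤ.≟ 0ℤ
... | yes _ = totalDegree-ofProductFrom n (suc j) cs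
... | no  _ = ℕ.⊔-lub (ℕ.≤-trans (ℕ.≤-reflexive (sum-replicate (suc n) j))
                                 (ℕ.*-monoʳ-≤ (suc n) (ℕ.m≤n⇒m≤1+n (ℕ.m≤m+n j (length cs)))))
                      (totalDegree-ofProductFrom n (suc j) cs)

coeffsVanishingBelow : ℤ → ℕ → List ℕ → List ℤ
coeffsVanishingBelow s K ps = map (s *ℤ_) (monicWithRoots (filter (_<? K) ps))

vanishingBelow : ∀ n → ℤ → ℕ → List ℕ → Poly (suc n)
vanishingBelow n s K ps = ofProductFrom n 0 (coeffsVanishingBelow s K ps)

eval-vanishingBelow : ∀ n s K ps (a : Vec ℕ (suc n)) →
  eval (vanishingBelow n s K ps) a ≡ s *ℤ horner (monicWithRoots (filter (_<? K) ps)) (+ prodℕ (toList a))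
eval-vanishingBelow n s K ps a =
  trans (eval-ofProductFrom n 0 (coeffsVanishingBelow s K ps) a)
        (trans (ℤ.*-identityˡ _) (horner-scale s (monicWithRoots (filter (_<? K) ps)) (+ prodℕ (toList a))))

eval-vanishingBelow-< : ∀ n s K ps (a : Vec ℕ (suc n)) → prodℕ (toList a) ∈ ps → prodℕ (toList a) < K →
                        eval (vanishingBelow n s K ps) a ≡ 0ℤ
eval-vanishingBelow-< n s K ps a a∈ps a<K =
  trans (eval-vanishingBelow n s K ps a)
        (trans (cong (s *ℤ_) (horner-monicWithRoots-root (∈-filter⁺ (_<? K) a∈ps a<K))) (ℤ.*-zeroʳ s))

eval-vanishingBelow-≡ : ∀ n s K ps (a : Vec ℕ (suc n)) → prodℕ (toList a) ≡ K →
                        ∃[ z ] (0ℤ <ℤ z × eval (vanishingBelow n s K ps) a ≡ s *ℤ z)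
eval-vanishingBelow-≡ n s K ps a refl =
  _ , horner-monicWithRoots-pos (all-filter (_<? K) ps) , eval-vanishingBelow n s K ps a

length-coeffsVanishingBelow : ∀ s K ps → K ∈ ps → length (coeffsVanishingBelow s K ps) ≤ length ps
length-coeffsVanishingBelow s K ps K∈ps = begin
  length (map (s *ℤ_) (monicWithRoots below)) ≡⟨ length-map (s *ℤ_) (monicWithRoots below) ⟩
  length (monicWithRoots below)               ≡⟨ length-monicWithRoots below ⟩
  suc (length below)                          ≤⟨ length-filter-<-∈ K∈ps ⟩
  length ps                                   ∎
  where
  open ℕ.≤-Reasoning
  below : List ℕ
  below = filter (_<? K) ps

sparsity-vanishingBelow : ∀ n s K ps → K ∈ ps → sparsity (vanishingBelow n s K ps) ≤ length ps
sparsity-vanishingBelow n s K ps K∈ps =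
  ℕ.≤-trans (sparsity-ofProductFrom n 0 (coeffsVanishingBelow s K ps))
            (length-coeffsVanishingBelow s K ps K∈ps)

totalDegree-vanishingBelow : ∀ n s K ps → K ∈ ps → totalDegree (vanishingBelow n s K ps) ≤ suc n * length ps
totalDegree-vanishingBelow n s K ps K∈ps =
  ℕ.≤-trans (totalDegree-ofProductFrom n 0 (coeffsVanishingBelow s K ps))
            (ℕ.*-monoʳ-≤ (suc n) (length-coeffsVanishingBelow s K ps K∈ps))

-- Polynomials supported at a single point

polarity : ℕ → ℤ
polarity zero    = 1ℤ
polarity (suc _) = -1ℤ

polarity-*-agrees : ∀ b {z} → 0ℤ <ℤ z → (b ≡ 0 → 0ℤ ≤ℤ polarity b *ℤ z) × (b ≡ 1 → polarity b *ℤ z ≤ℤ 0ℤ)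
polarity-*-agrees zero    (+<+ z<s) = (λ _ → +≤+ z≤n) , λ ()
polarity-*-agrees (suc b) (+<+ z<s) = (λ ()) , λ _ → -≤+

polarity-*-≢0 : ∀ b {z} → 0ℤ <ℤ z → polarity b *ℤ z ≢ 0ℤ
polarity-*-≢0 zero    (+<+ z<s) ()
polarity-*-≢0 (suc b) (+<+ z<s) ()

weaklySignRepresents-singleSupport : ∀ {n} {A : List ℕ} {f : Vec ℕ n → ℕ} {P : Poly n}
  (r : Vec ℕ n) → All (_∈ A) r →
  (∀ a → All (_∈ A) a → eval P a ≡ 0ℤ ⊎ a ≡ r) →
  ∃[ z ] (0ℤ <ℤ z × eval P r ≡ polarity (f r) *ℤ z) →
  WeaklySignRepresents A f P
weaklySignRepresents-singleSupport {A = A} {f} {P} r r∈Aⁿ supported (z , z>0 , P[r]) =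
  represents , r , r∈Aⁿ , λ P[r]≡0 → polarity-*-≢0 (f r) z>0 (trans (sym P[r]) P[r]≡0)
  where
  represents : ∀ a → All (_∈ A) a → (f a ≡ 0 → 0ℤ ≤ℤ eval P a) × (f a ≡ 1 → eval P a ≤ℤ 0ℤ)
  represents a a∈Aⁿ with supported a a∈Aⁿ
  ... | inj₁ P[a]≡0 = (λ _ → ℤ.≤-reflexive (sym P[a]≡0)) , (λ _ → ℤ.≤-reflexive P[a]≡0)
  ... | inj₂ refl   = subst (λ p → (f a ≡ 0 → 0ℤ ≤ℤ p) × (f a ≡ 1 → p ≤ℤ 0ℤ)) (sym P[r])
                            (polarity-*-agrees (f a) z>0)

weaklySignRepresentable : ∀ n x A (f : Vec ℕ (suc n) → ℕ) →
  ∃[ P ] (WeaklySignRepresents (x ∷ A) f P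
          × sparsity P ≤ (suc n + length (x ∷ A) ∸ 1) C suc n
          × totalDegree P ≤ suc n * ((suc n + length (x ∷ A) ∸ 1) C suc n))
weaklySignRepresentable n x A f =
  P , weaklySignRepresents-singleSupport {P = P} r r∈Bⁿ supported
        (eval-vanishingBelow-≡ n s K products r (product-replicate (suc n) M))
    , subst (sparsity P ≤_) length-products (sparsity-vanishingBelow n s K products K∈products)
    , subst (λ k → totalDegree P ≤ suc n * k) length-products
            (totalDegree-vanishingBelow n s K products K∈products)
  where
  B products : List ℕ
  B        = x ∷ A
  products = multisetProducts (suc n) B
  M K : ℕ
  M = max x A
  K = M ^ suc n
  r : Vec ℕ (suc n)
  r = replicate (suc n) M
  s : ℤ
  s = polarity (f r)
  P : Poly (suc n)
  P = vanishingBelow n s K products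

  length-products : length products ≡ (suc n + length B ∸ 1) C suc n
  length-products = length-multisetProducts (suc n) B

  r∈Bⁿ : All (_∈ B) r
  r∈Bⁿ = replicate⁺ (suc n) (max-∈ x A)

  K∈products : K ∈ products
  K∈products = subst (_∈ products) (product-replicate (suc n) M) (product-∈-multisetProducts r∈Bⁿ)

  supported : ∀ a → All (_∈ B) a → eval P a ≡ 0ℤ ⊎ a ≡ r
  supported a a∈Bⁿ with prodℕ (toList a) <? K
  ... | yes a<K = inj₁ (eval-vanishingBelow-< n s K products a (product-∈-multisetProducts a∈Bⁿ) a<K)
  ... | no  a≮K = inj₂ (pow-≤-product⇒≡replicate M (All.map (AllL.lookup (≤-max x A)) a∈Bⁿ) (ℕ.≮⇒≥ a≮K))

theorem4p2 : (m n : ℕ) (A : List ℕ) → Unique A → length A ≡ m → 1 ≤ m → 1 ≤ n →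
    ∃[ P ] (WeaklySignRepresents {n} A Par P
            × sparsity P ≤ (n + m ∸ 1) C n
            × totalDegree P ≤ n * ((n + m ∸ 1) C n))
theorem4p2 _ zero    _       _ _    _  ()
theorem4p2 _ (suc n) []      _ refl () _
theorem4p2 _ (suc n) (x ∷ A) _ refl _  _ = weaklySignRepresentable n x A Par
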